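{- Let $(p':W\to A,q':W\to B)$ be the comma span of some cospan $(j':A\to C',k':B\to C')$ in $\mathsf{Pos}$, and let $(j:A\to C,k:B\to C)$ be a cospan in $\mathsf{Pos}$ such that the square formed by $p',q',j,k$ is exact. Then $(p',q')$ is the comma of the cospan $(j,k)$.
   Context: $\mathsf{Pos}$ is the category of posets and monotone maps. The comma of a cospan $A\xrightarrow{j}C\xleftarrow{k}B$ is a span $A\xleftarrow{p}W\xrightarrow{q}B$ with $jp\le kq$ (pointwise) such that every span $(p'',q'')$ with $jp''\le kq''$ factors uniquely through $(p,q)$, the factorisation being monotone in the span. A square $p,q,j,k$ is exact if $jp\le kq$ and for all $a\in A,b\in B$ with $j(a)\le k(b)$ there is $w\in W$ with $a\le p(w)$ and $q(w)\le b$. -}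

module Defs where

open import Level using (Level; _⊔_; suc)
open import Data.Product using (Σ; _×_; _,_; ∃-syntax)
open import Relation.Binary.Bundles using (Poset)
open import Relation.Binary.Morphism.Bundles using (PosetHomomorphism)

_⇒_ : ∀ {c ℓ₁ ℓ₂} → Poset c ℓ₁ ℓ₂ → Poset c ℓ₁ ℓ₂ → Set (c ⊔ ℓ₁ ⊔ ℓ₂)
P ⇒ Q = PosetHomomorphism P Q

module _ {c ℓ₁ ℓ₂ : Level} where

  ap : {P Q : Poset c ℓ₁ ℓ₂} → P ⇒ Q → Poset.Carrier P → Poset.Carrier Q
  ap f = PosetHomomorphism.⟦_⟧ f

  _≤ᵖ_ : {P Q : Poset c ℓ₁ ℓ₂} → P ⇒ Q → P ⇒ Q → Set (c ⊔ ℓ₂)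
  _≤ᵖ_ {P} {Q} f g = ∀ (x : Poset.Carrier P) → Poset._≤_ Q (ap f x) (ap g x)

  _≈ᵖ_ : {P Q : Poset c ℓ₁ ℓ₂} → P ⇒ Q → P ⇒ Q → Set (c ⊔ ℓ₁)
  _≈ᵖ_ {P} {Q} f g = ∀ (x : Poset.Carrier P) → Poset._≈_ Q (ap f x) (ap g x)

  LaxSquare : {W A B C : Poset c ℓ₁ ℓ₂} →
              W ⇒ A → W ⇒ B → A ⇒ C → B ⇒ C → Set (c ⊔ ℓ₂)
  LaxSquare {W} {A} {B} {C} p q j k =
    ∀ (w : Poset.Carrier W) → Poset._≤_ C (ap j (ap p w)) (ap k (ap q w))

  record IsComma {W A B C : Poset c ℓ₁ ℓ₂}
                 (p : W ⇒ A) (q : W ⇒ B) (j : A ⇒ C) (k : B ⇒ C)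
                 : Set (suc (c ⊔ ℓ₁ ⊔ ℓ₂)) where
    field
      lax : LaxSquare p q j k
      factor : (V : Poset c ℓ₁ ℓ₂) (p'' : V ⇒ A) (q'' : V ⇒ B) →
               LaxSquare p'' q'' j k →
               Σ (V ⇒ W) λ h →
                 ((∀ v → Poset._≈_ A (ap p (ap h v)) (ap p'' v)) ×
                  (∀ v → Poset._≈_ B (ap q (ap h v)) (ap q'' v)))
      unique : (V : Poset c ℓ₁ ℓ₂) (p'' : V ⇒ A) (q'' : V ⇒ B) →
               (s : LaxSquare p'' q'' j k) (h' : V ⇒ W) →
               (∀ v → Poset._≈_ A (ap p (ap h' v)) (ap p'' v)) →
               (∀ v → Poset._≈_ B (ap q (ap h' v)) (ap q'' v)) →
               h' ≈ᵖ Σ.proj₁ (factor V p'' q'' s)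
      factor-mono : (V : Poset c ℓ₁ ℓ₂) (p₁ p₂ : V ⇒ A) (q₁ q₂ : V ⇒ B) →
                    (s₁ : LaxSquare p₁ q₁ j k) (s₂ : LaxSquare p₂ q₂ j k) →
                    p₁ ≤ᵖ p₂ → q₁ ≤ᵖ q₂ →
                    Σ.proj₁ (factor V p₁ q₁ s₁) ≤ᵖ Σ.proj₁ (factor V p₂ q₂ s₂)

  IsExact : {W A B C : Poset c ℓ₁ ℓ₂} →
            W ⇒ A → W ⇒ B → A ⇒ C → B ⇒ C → Set (c ⊔ ℓ₂)
  IsExact {W} {A} {B} {C} p q j k =
    LaxSquare p q j k ×
    (∀ (a : Poset.Carrier A) (b : Poset.Carrier B) →
       Poset._≤_ C (ap j a) (ap k b) →
       ∃[ w ] (Poset._≤_ A a (ap p w) × Poset._≤_ B (ap q w) b))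

-- By exactness, j a ≤ k b yields w with a ≤ p' w and q' w ≤ b, hence
-- j' a ≤ j' (p' w) ≤ k' (q' w) ≤ k' b. So every lax square over (j, k) is one
-- over (j', k'), and the universal property of (p', q') for (j', k') restricts
-- to one for (j, k).
module Submission where

open import Defs
open import Level using (Level)
open import Relation.Binary.Bundles using (Poset)
open import Relation.Binary.Morphism.Bundles using (PosetHomomorphism)
open import Data.Product using (_,_)

open PosetHomomorphism using (mono)

module _ {c ℓ₁ ℓ₂ : Level} {W A B C C' : Poset c ℓ₁ ℓ₂} where

  exact⇒laxSquare-reflect : (p : W ⇒ A) (q : W ⇒ B)
    (j : A ⇒ C) (k : B ⇒ C) (j' : A ⇒ C') (k' : B ⇒ C') →
    LaxSquare p q j' k' → IsExact p q j k →
    ∀ (V : Poset c ℓ₁ ℓ₂) (p'' : V ⇒ A) (q'' : V ⇒ B) →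
    LaxSquare p'' q'' j k → LaxSquare p'' q'' j' k'
  exact⇒laxSquare-reflect _ _ _ _ j' k' lax' (_ , exact) V p'' q'' s v
    with exact (ap p'' v) (ap q'' v) (s v)
  ... | w , a≤pw , qw≤b = trans (mono j' a≤pw) (trans (lax' w) (mono k' qw≤b))
    where open Poset C' using (trans)

  isComma-restrict : (p : W ⇒ A) (q : W ⇒ B)
    (j : A ⇒ C) (k : B ⇒ C) (j' : A ⇒ C') (k' : B ⇒ C') →
    IsComma p q j' k' → LaxSquare p q j k →
    (∀ (V : Poset c ℓ₁ ℓ₂) (p'' : V ⇒ A) (q'' : V ⇒ B) →
       LaxSquare p'' q'' j k → LaxSquare p'' q'' j' k') →
    IsComma p q j k
  isComma-restrict _ _ _ _ _ _ comma laxSquare transfer = record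
    { lax = laxSquare
    ; factor = λ V p'' q'' s → factor V p'' q'' (transfer V p'' q'' s)
    ; unique = λ V p'' q'' s → unique V p'' q'' (transfer V p'' q'' s)
    ; factor-mono = λ V p₁ p₂ q₁ q₂ s₁ s₂ →
        factor-mono V p₁ p₂ q₁ q₂ (transfer V p₁ q₁ s₁) (transfer V p₂ q₂ s₂)
    }
    where open IsComma comma using (factor; unique; factor-mono)

proposition3p10 : ∀ {c ℓ₁ ℓ₂ : Level} {W A B C C' : Poset c ℓ₁ ℓ₂}
    (p' : W ⇒ A) (q' : W ⇒ B) (j' : A ⇒ C') (k' : B ⇒ C')
    (j : A ⇒ C) (k : B ⇒ C) →
    IsComma p' q' j' k' → IsExact p' q' j k → IsComma p' q' j k
proposition3p10 p' q' j' k' j k comma exact@(lax , _) =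
  isComma-restrict p' q' j k j' k' comma lax
    (exact⇒laxSquare-reflect p' q' j k j' k' (IsComma.lax comma) exact)
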